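{- For all sufficiently large $n$, there exists a set $V$ of $2^{2^{\lfloor n/2\rfloor}}$ points in the plane in general position and a coloring of all 3-element subsets of $V$ with two colors such that there is no subset $S\subseteq V$ of $2n$ points in convex position all of whose 3-element subsets receive the same color.
   Context: A set of points in the plane is in general position if no three are collinear. -}

module Defs where

open import Data.Nat as ℕ using (ℕ; zero; suc)
open import Data.Fin using (Fin; zero; suc; _<_)
open import Data.Rational using (ℚ; 0ℚ; 1ℚ; _+_; _*_; _-_; _≤_)
open import Data.Product using (_×_; _,_; proj₁; proj₂; Σ; ∃)
open import Relation.Binary.PropositionalEquality using (_≡_; _≢_)
open import Function.Definitions using (Injective)

Point : Set
Point = ℚ × ℚ

sumℚ : ∀ {n} → (Fin n → ℚ) → ℚ
sumℚ {zero}  f = 0ℚ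
sumℚ {suc n} f = f zero + sumℚ (λ i → f (suc i))

orient : Point → Point → Point → ℚ
orient (px , py) (qx , qy) (rx , ry) =
  ((qx - px) * (ry - py)) - ((qy - py) * (rx - px))

Collinear : Point → Point → Point → Set
Collinear p q r = orient p q r ≡ 0ℚ

GeneralPosition : ∀ {N} → (Fin N → Point) → Set
GeneralPosition {N} P =
  (i j k : Fin N) → i ≢ j → j ≢ k → i ≢ k → Collinear (P i) (P j) (P k) → Data.Empty.⊥
  where import Data.Empty

-- p lies in the convex hull of the points Q b for b ≠ a:
-- p is a convex combination (nonnegative coefficients summing to 1,
-- coefficient of index a equal to 0) of the family Q.
InHullExcept : ∀ {m} → (Fin m → Point) → Fin m → Point → Set
InHullExcept {m} Q a p =
  Σ (Fin m → ℚ) λ λs →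
    (λs a ≡ 0ℚ) ×
    ((b : Fin m) → 0ℚ ≤ λs b) ×
    (sumℚ λs ≡ 1ℚ) ×
    (sumℚ (λ b → λs b * proj₁ (Q b)) ≡ proj₁ p) ×
    (sumℚ (λ b → λs b * proj₂ (Q b)) ≡ proj₂ p)

ConvexPosition : ∀ {m} → (Fin m → Point) → Set
ConvexPosition {m} Q = (a : Fin m) → InHullExcept Q a (Q a) → Data.Empty.⊥
  where import Data.Empty

-- Strictly increasing maps Fin m → Fin N enumerate the m-element subsets of Fin N.
StrictlyIncreasing : ∀ {m N} → (Fin m → Fin N) → Set
StrictlyIncreasing {m} f = (a b : Fin m) → a < b → f a < f b

-- A 2-colouring of the 3-element subsets of Fin N: the colour of {i,j,k}
-- with i < j < k is χ i j k (values on other ordered triples are irrelevant).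
TripleColouring : ℕ → Set
TripleColouring N = Fin N → Fin N → Fin N → Fin 2

Monochromatic : ∀ {m N} → TripleColouring N → (Fin m → Fin N) → Fin 2 → Set
Monochromatic {m} χ f c =
  (a b d : Fin m) → a < b → b < d → χ (f a) (f b) (f d) ≡ c

module Submission where

-- Place the points (a , height a), a < 2 ^ K, so that the upper half of the set is a copy of the
-- lower half lifted far above it. Then a < b < c turn left exactly when the level of {a, b} (the
-- highest binary digit in which a and b differ) is below the level of {b, c}, and levels behave
-- like an ultrametric. A triple is coloured by its two distinct levels, through an Erdős
-- colouring of the pairs of the K = 2 ^ ⌊n/2⌋ levels without homogeneous n-sets. In a convex
-- 2n-gon listed from left to right the sequence of consecutive levels has no valley, since a
-- valley puts a vertex inside the triangle of three others; so its first n or its last n terms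
-- are monotone, and they form a homogeneous n-set of levels.

open import Defs
open import Data.Nat
open import Data.Nat.Properties
open import Data.Nat.DivMod using (_mod_; m<n⇒m%n≡m; m/n*n≤m)
import Data.Nat.Solver
open import Algebra.Properties.CommutativeSemigroup +-commutativeSemigroup using () renaming (interchange to +-interchange)
open import Data.Fin as Fin using (Fin; zero; suc; toℕ)
import Data.Fin.Properties as Fin
open import Data.Fin.Properties using (2↔Bool)
open import Data.Rational as ℚ using (ℚ; 0ℚ; 1ℚ)
import Data.Rational.Properties as ℚ
import Data.Rational.Solver
open import Data.Bool using (Bool; true; false; not; if_then_else_)
open import Data.Maybe using (Maybe; just; nothing)
open import Data.List using (List; []; _∷_; length; _++_; map; applyUpTo; applyDownFrom)
open import Data.List.Properties using (length-++; length-map; length-applyUpTo; length-applyDownFrom)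
open import Data.List.Relation.Unary.All using (All; []; _∷_)
import Data.List.Relation.Unary.All as All
import Data.List.Relation.Unary.All.Properties as All
open import Data.List.Relation.Unary.AllPairs using (AllPairs; []; _∷_)
import Data.List.Relation.Unary.AllPairs as AllPairs
import Data.List.Relation.Unary.AllPairs.Properties as AllPairs
open import Data.List.Relation.Unary.Any using (here; there)
open import Data.List.Membership.Propositional using (_∈_)
open import Data.List.Membership.Propositional.Properties using (∈-map⁺; ∈-++⁺ˡ; ∈-++⁺ʳ)
open import Data.Product using (Σ; _×_; _,_; proj₁; proj₂)
open import Data.Sum using (_⊎_; inj₁; inj₂)
open import Data.Unit using (tt)
open import Data.Empty using (⊥; ⊥-elim)
open import Function using (_∘_; case_of_)
open import Function.Bundles using (Inverse)
open import Function.Definitions using (Injective)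
open import Relation.Nullary using (¬_; yes; no)
open import Relation.Binary.PropositionalEquality
open import Relation.Binary.Definitions using (tri<; tri≈; tri>)

module ℕ-Solver = Data.Nat.Solver.+-*-Solver
module ℚ-Solver = Data.Rational.Solver.+-*-Solver

2^suc : ∀ k → 2 ^ suc k ≡ 2 ^ k + 2 ^ k
2^suc k = cong (2 ^ k +_) (+-identityʳ (2 ^ k))

upperHalf-shift : ∀ k c → c < 2 ^ suc k → ¬ c < 2 ^ k → c ∸ 2 ^ k < 2 ^ k
upperHalf-shift k c c<2^[1+k] c≮2^k =
  subst (c ∸ 2 ^ k <_) (m+n∸m≡n (2 ^ k) (2 ^ k))
    (∸-monoˡ-< (subst (c <_) (2^suc k) c<2^[1+k]) (≮⇒≥ c≮2^k))

-- For a ≠ b below 2 ^ k, level k a b is the position of the highest binary digit in which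
-- a and b differ.
level : ℕ → ℕ → ℕ → ℕ
level zero    a b = 0
level (suc k) a b with a <? 2 ^ k | b <? 2 ^ k
... | yes _ | yes _ = level k a b
... | no _  | no _  = level k (a ∸ 2 ^ k) (b ∸ 2 ^ k)
... | yes _ | no _  = k
... | no _  | yes _ = k

level< : ∀ k a b → a < b → b < 2 ^ k → level k a b < k
level< zero a zero () _
level< zero a (suc b) _ (s≤s ())
level< (suc k) a b a<b b< with a <? 2 ^ k | b <? 2 ^ k
... | yes _  | yes b<' = m<n⇒m<1+n (level< k a b a<b b<')
... | no a≮  | no b≮   =
  m<n⇒m<1+n (level< k (a ∸ 2 ^ k) (b ∸ 2 ^ k) (∸-monoˡ-< a<b (≮⇒≥ a≮)) (upperHalf-shift k b b< b≮))
... | yes _  | no _    = ≤-refl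
... | no _   | yes _   = ≤-refl

level-ultrametric : ∀ k a b c → a < b → b < c → c < 2 ^ k →
  level k a b ≢ level k b c × level k a c ≡ level k a b ⊔ level k b c
level-ultrametric zero a b zero _ () _
level-ultrametric zero a b (suc c) _ _ (s≤s ())
level-ultrametric (suc k) a b c a<b b<c c< with a <? 2 ^ k | b <? 2 ^ k | c <? 2 ^ k
... | yes a< | yes b< | yes c<' = level-ultrametric k a b c a<b b<c c<'
... | yes a< | yes b< | no c≮ =
    <⇒≢ ab<k , sym (m≤n⇒m⊔n≡n (<⇒≤ ab<k))
  where
  ab<k : level k a b < k
  ab<k = level< k a b a<b b<
... | yes a< | no b≮ | no c≮ =
    ≢-sym (<⇒≢ bc<k) , sym (m≥n⇒m⊔n≡m (<⇒≤ bc<k))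
  where
  bc<k : level k (b ∸ 2 ^ k) (c ∸ 2 ^ k) < k
  bc<k = level< k (b ∸ 2 ^ k) (c ∸ 2 ^ k) (∸-monoˡ-< b<c (≮⇒≥ b≮)) (upperHalf-shift k c c< c≮)
... | no a≮ | no b≮ | no c≮ =
    level-ultrametric k (a ∸ 2 ^ k) (b ∸ 2 ^ k) (c ∸ 2 ^ k)
      (∸-monoˡ-< a<b (≮⇒≥ a≮)) (∸-monoˡ-< b<c (≮⇒≥ b≮)) (upperHalf-shift k c c< c≮)
... | yes _  | no b≮ | yes c<' = ⊥-elim (b≮ (<-trans b<c c<'))
... | no a≮  | yes b< | _      = ⊥-elim (a≮ (<-trans a<b b<))
... | no _   | no b≮ | yes c<' = ⊥-elim (b≮ (<-trans b<c c<'))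

-- The upper half of the points is the lower half translated by (2 ^ k , gap k); gap k exceeds
-- every (u + w) * maxHeight k with u + w ≤ 2 ^ suc k, so it decides all turns across the halves.
maxHeight gap : ℕ → ℕ
gap k = 2 ^ suc k * maxHeight k + 1
maxHeight zero    = 0
maxHeight (suc k) = gap k + maxHeight k

height : ℕ → ℕ → ℕ
height zero    a = 0
height (suc k) a with a <? 2 ^ k
... | yes _ = height k a
... | no _  = gap k + height k (a ∸ 2 ^ k)

height≤maxHeight : ∀ k a → a < 2 ^ k → height k a ≤ maxHeight k
height≤maxHeight zero    a _ = z≤n
height≤maxHeight (suc k) a a< with a <? 2 ^ k
... | yes a<' = ≤-trans (height≤maxHeight k a a<') (m≤n+m (maxHeight k) (gap k))
... | no a≮   = +-monoʳ-≤ (gap k) (height≤maxHeight k (a ∸ 2 ^ k) (upperHalf-shift k a a< a≮))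

-- For b = a + u and c = b + w, chord and middle are (u + w) times the heights at b
-- of the segment from a to c and of the point b itself.
chord middle : ℕ → ℕ → ℕ → ℕ → ℕ
chord  k a u w = u * height k (a + u + w) + w * height k a
middle k a u w = (u + w) * height k (a + u)

gap-dominates : ∀ k {d} → d ≤ 2 ^ suc k → d * maxHeight k < gap k
gap-dominates k d≤ = ≤-<-trans (*-monoˡ-≤ (maxHeight k) d≤) (m<m+n _ z<s)

private
  raise-chord : ∀ g u w y z → u * (g + y) + w * (g + z) ≡ (u + w) * g + (u * y + w * z)
  raise-chord = solve 5 (λ g u w y z → u :* (g :+ y) :+ w :* (g :+ z) := (u :+ w) :* g :+ (u :* y :+ w :* z)) refl
    where open ℕ-Solver

  u+w≤m : ∀ a u w {m} → a + u + w < m → u + w ≤ m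
  u+w≤m a u w lt = <⇒≤ (≤-<-trans (≤-trans (m≤n+m (u + w) a) (≤-reflexive (sym (+-assoc a u w)))) lt)

  +-∸-comm₃ : ∀ k a u w → ¬ a < 2 ^ k → a + u + w ∸ 2 ^ k ≡ a ∸ 2 ^ k + u + w
  +-∸-comm₃ k a u w a≮ =
    trans (+-∸-comm w (≤-trans (≮⇒≥ a≮) (m≤m+n a u))) (cong (_+ w) (+-∸-comm u (≮⇒≥ a≮)))

  upperHalf-shift₃ : ∀ k a u w → a + u + w < 2 ^ suc k → ¬ a < 2 ^ k → ¬ a + u + w < 2 ^ k →
                     a ∸ 2 ^ k + u + w < 2 ^ k
  upperHalf-shift₃ k a u w c< a≮ c≮ = subst (_< 2 ^ k) (+-∸-comm₃ k a u w a≮) (upperHalf-shift k _ c< c≮)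

middle<chord : ∀ k a u w → 0 < u → 0 < w → a + u + w < 2 ^ k →
  level k a (a + u) < level k (a + u) (a + u + w) → middle k a u w < chord k a u w
middle<chord zero a u w _ _ _ ()
middle<chord (suc k) a u w 0<u 0<w c< lv with a <? 2 ^ k | a + u <? 2 ^ k | a + u + w <? 2 ^ k
... | yes a< | yes b< | yes c<' = middle<chord k a u w 0<u 0<w c<' lv
... | yes a< | yes b< | no c≮ = begin-strict
  (u + w) * height k (a + u)   ≤⟨ *-monoʳ-≤ (u + w) (height≤maxHeight k (a + u) b<) ⟩
  (u + w) * maxHeight k        <⟨ gap-dominates k (u+w≤m a u w c<) ⟩
  gap k                        ≤⟨ m≤m+n (gap k) _ ⟩
  gap k + height k (a + u + w ∸ 2 ^ k)           ≤⟨ m≤n*m _ u {{>-nonZero 0<u}} ⟩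
  u * (gap k + height k (a + u + w ∸ 2 ^ k))     ≤⟨ m≤m+n _ _ ⟩
  u * (gap k + height k (a + u + w ∸ 2 ^ k)) + w * height k a ∎
  where open ≤-Reasoning
... | yes a< | no b≮ | no c≮ = ⊥-elim (<⇒≱ lv (<⇒≤ (level< k _ _
  (∸-monoˡ-< (m<m+n (a + u) 0<w) (≮⇒≥ b≮)) (upperHalf-shift k _ c< c≮))))
... | no a≮ | no b≮ | no c≮ rewrite +-∸-comm₃ k a u w a≮ | +-∸-comm u (≮⇒≥ a≮) =
  subst₂ _<_ (sym (*-distribˡ-+ (u + w) (gap k) _)) (sym (raise-chord (gap k) u w _ _))
    (+-monoʳ-< ((u + w) * gap k) (middle<chord k (a ∸ 2 ^ k) u w 0<u 0<w (upperHalf-shift₃ k a u w c< a≮ c≮) lv))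
... | no a≮ | yes b< | _      = ⊥-elim (a≮ (≤-<-trans (m≤m+n a u) b<))
... | _     | no b≮ | yes c<' = ⊥-elim (b≮ (≤-<-trans (m≤m+n (a + u) w) c<'))

chord<middle : ∀ k a u w → 0 < u → 0 < w → a + u + w < 2 ^ k →
  level k (a + u) (a + u + w) < level k a (a + u) → chord k a u w < middle k a u w
chord<middle zero a u w _ _ _ ()
chord<middle (suc k) a u w 0<u 0<w c< lv with a <? 2 ^ k | a + u <? 2 ^ k | a + u + w <? 2 ^ k
... | yes a< | yes b< | yes c<' = chord<middle k a u w 0<u 0<w c<' lv
... | yes a< | yes b< | no c≮ = ⊥-elim (<⇒≱ lv (<⇒≤ (level< k a (a + u) (m<m+n a 0<u) b<)))
... | yes a< | no b≮ | no c≮ = begin-strict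
  u * (gap k + height k c') + w * height k a
    ≤⟨ +-mono-≤ (*-monoʳ-≤ u (+-monoʳ-≤ (gap k) (height≤maxHeight k c' c'<)))
                (*-monoʳ-≤ w (height≤maxHeight k a a<)) ⟩
  u * (gap k + maxHeight k) + w * maxHeight k
    ≡⟨ solve 4 (λ u w g m → u :* (g :+ m) :+ w :* m := u :* g :+ (u :+ w) :* m) refl u w (gap k) (maxHeight k) ⟩
  u * gap k + (u + w) * maxHeight k
    <⟨ +-monoʳ-< (u * gap k) (gap-dominates k (u+w≤m a u w c<)) ⟩
  u * gap k + gap k
    ≤⟨ +-monoʳ-≤ (u * gap k) (m≤n*m (gap k) w {{>-nonZero 0<w}}) ⟩
  u * gap k + w * gap k
    ≡⟨ *-distribʳ-+ (gap k) u w ⟨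
  (u + w) * gap k
    ≤⟨ *-monoʳ-≤ (u + w) (m≤m+n (gap k) _) ⟩
  (u + w) * (gap k + height k (a + u ∸ 2 ^ k)) ∎
  where
  open ≤-Reasoning; open ℕ-Solver
  c' : ℕ
  c' = a + u + w ∸ 2 ^ k
  c'< : c' < 2 ^ k
  c'< = upperHalf-shift k _ c< c≮
... | no a≮ | no b≮ | no c≮ rewrite +-∸-comm₃ k a u w a≮ | +-∸-comm u (≮⇒≥ a≮) =
  subst₂ _<_ (sym (raise-chord (gap k) u w _ _)) (sym (*-distribˡ-+ (u + w) (gap k) _))
    (+-monoʳ-< ((u + w) * gap k) (chord<middle k (a ∸ 2 ^ k) u w 0<u 0<w (upperHalf-shift₃ k a u w c< a≮ c≮) lv))
... | no a≮ | yes b< | _      = ⊥-elim (a≮ (≤-<-trans (m≤m+n a u) b<))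
... | _     | no b≮ | yes c<' = ⊥-elim (b≮ (≤-<-trans (m≤m+n (a + u) w) c<'))

toℚ : ℕ → ℚ
toℚ zero    = 0ℚ
toℚ (suc n) = 1ℚ ℚ.+ toℚ n

toℚ-+ : ∀ m n → toℚ (m + n) ≡ toℚ m ℚ.+ toℚ n
toℚ-+ zero    n = sym (ℚ.+-identityˡ (toℚ n))
toℚ-+ (suc m) n = trans (cong (1ℚ ℚ.+_) (toℚ-+ m n)) (sym (ℚ.+-assoc 1ℚ (toℚ m) (toℚ n)))

toℚ-* : ∀ m n → toℚ (m * n) ≡ toℚ m ℚ.* toℚ n
toℚ-* zero    n = sym (ℚ.*-zeroˡ (toℚ n))
toℚ-* (suc m) n = begin
  toℚ (n + m * n)            ≡⟨ toℚ-+ n (m * n) ⟩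
  toℚ n ℚ.+ toℚ (m * n)      ≡⟨ cong (toℚ n ℚ.+_) (toℚ-* m n) ⟩
  toℚ n ℚ.+ toℚ m ℚ.* toℚ n  ≡⟨ solve 2 (λ x y → y :+ x :* y := (con 1ℚ :+ x) :* y) refl (toℚ m) (toℚ n) ⟩
  (1ℚ ℚ.+ toℚ m) ℚ.* toℚ n   ∎
  where open ≡-Reasoning; open ℚ-Solver

toℚ-≤ : ∀ {m n} → m ≤ n → toℚ m ℚ.≤ toℚ n
toℚ-≤ {n = n} z≤n = nonneg n
  where
  nonneg : ∀ n → 0ℚ ℚ.≤ toℚ n
  nonneg zero    = ℚ.≤-refl
  nonneg (suc n) = ℚ.+-mono-≤ (ℚ.<⇒≤ (ℚ.positive⁻¹ 1ℚ)) (nonneg n)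
toℚ-≤ (s≤s m≤n) = ℚ.+-monoʳ-≤ 1ℚ (toℚ-≤ m≤n)

toℚ-< : ∀ {m n} → m < n → toℚ m ℚ.< toℚ n
toℚ-< {m} {suc n} (s≤s m≤n) = ℚ.≤-<-trans (toℚ-≤ m≤n)
  (subst (ℚ._< 1ℚ ℚ.+ toℚ n) (ℚ.+-identityˡ (toℚ n)) (ℚ.+-monoˡ-< (toℚ n) (ℚ.positive⁻¹ 1ℚ)))

toℚ-injective : ∀ {m n} → toℚ m ≡ toℚ n → m ≡ n
toℚ-injective {m} {n} eq with <-cmp m n
... | tri< m<n _ _ = ⊥-elim (ℚ.<-irrefl eq (toℚ-< m<n))
... | tri≈ _ m≡n _ = m≡n
... | tri> _ _ n<m = ⊥-elim (ℚ.<-irrefl (sym eq) (toℚ-< n<m))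

orient-swap : ∀ p q r → orient p r q ≡ ℚ.- orient p q r
orient-swap (px , py) (qx , qy) (rx , ry) = solve 6 (λ px py qx qy rx ry →
  ((rx :- px) :* (qy :- py)) :- ((ry :- py) :* (qx :- px))
  := :- (((qx :- px) :* (ry :- py)) :- ((qy :- py) :* (rx :- px)))) refl px py qx qy rx ry
  where open ℚ-Solver

orient-rotate : ∀ p q r → orient q r p ≡ orient p q r
orient-rotate (px , py) (qx , qy) (rx , ry) = solve 6 (λ px py qx qy rx ry →
  ((rx :- qx) :* (py :- qy)) :- ((ry :- qy) :* (px :- qx))
  := ((qx :- px) :* (ry :- py)) :- ((qy :- py) :* (rx :- px))) refl px py qx qy rx ry
  where open ℚ-Solver

-- Cramer's rule: the orientations of the sub-triangles through x are the
-- barycentric coordinates of x in the triangle a b c, scaled by orient a b c.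
barycentric-weight : ∀ a b c x → orient x b c ℚ.+ orient a x c ℚ.+ orient a b x ≡ orient a b c
barycentric-weight (ax , ay) (bx , by) (cx , cy) (xx , xy) = solve 8 (λ ax ay bx by cx cy xx xy →
  ((bx :- xx) :* (cy :- xy)) :- ((by :- xy) :* (cx :- xx))
  :+ (((xx :- ax) :* (cy :- ay)) :- ((xy :- ay) :* (cx :- ax)))
  :+ (((bx :- ax) :* (xy :- ay)) :- ((by :- ay) :* (xx :- ax)))
  := ((bx :- ax) :* (cy :- ay)) :- ((by :- ay) :* (cx :- ax))) refl ax ay bx by cx cy xx xy
  where open ℚ-Solver

barycentric-x : ∀ a b c x →
  orient x b c ℚ.* proj₁ a ℚ.+ orient a x c ℚ.* proj₁ b ℚ.+ orient a b x ℚ.* proj₁ c ≡ orient a b c ℚ.* proj₁ x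
barycentric-x (ax , ay) (bx , by) (cx , cy) (xx , xy) = solve 8 (λ ax ay bx by cx cy xx xy →
  (((bx :- xx) :* (cy :- xy)) :- ((by :- xy) :* (cx :- xx))) :* ax
  :+ (((xx :- ax) :* (cy :- ay)) :- ((xy :- ay) :* (cx :- ax))) :* bx
  :+ (((bx :- ax) :* (xy :- ay)) :- ((by :- ay) :* (xx :- ax))) :* cx
  := (((bx :- ax) :* (cy :- ay)) :- ((by :- ay) :* (cx :- ax))) :* xx) refl ax ay bx by cx cy xx xy
  where open ℚ-Solver

barycentric-y : ∀ a b c x →
  orient x b c ℚ.* proj₂ a ℚ.+ orient a x c ℚ.* proj₂ b ℚ.+ orient a b x ℚ.* proj₂ c ≡ orient a b c ℚ.* proj₂ x
barycentric-y (ax , ay) (bx , by) (cx , cy) (xx , xy) = solve 8 (λ ax ay bx by cx cy xx xy →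
  (((bx :- xx) :* (cy :- xy)) :- ((by :- xy) :* (cx :- xx))) :* ay
  :+ (((xx :- ax) :* (cy :- ay)) :- ((xy :- ay) :* (cx :- ax))) :* by
  :+ (((bx :- ax) :* (xy :- ay)) :- ((by :- ay) :* (xx :- ax))) :* cy
  := (((bx :- ax) :* (cy :- ay)) :- ((by :- ay) :* (cx :- ax))) :* xy) refl ax ay bx by cx cy xx xy
  where open ℚ-Solver

sumℚ-cong : ∀ {m} {f g : Fin m → ℚ} → (∀ b → f b ≡ g b) → sumℚ f ≡ sumℚ g
sumℚ-cong {zero}  f≗g = refl
sumℚ-cong {suc m} f≗g = cong₂ ℚ._+_ (f≗g zero) (sumℚ-cong (λ b → f≗g (suc b)))

sumℚ-+ : ∀ {m} (f g : Fin m → ℚ) → sumℚ (λ b → f b ℚ.+ g b) ≡ sumℚ f ℚ.+ sumℚ g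
sumℚ-+ {zero}  f g = sym (ℚ.+-identityˡ 0ℚ)
sumℚ-+ {suc m} f g = trans (cong (f zero ℚ.+ g zero ℚ.+_) (sumℚ-+ (λ b → f (suc b)) (λ b → g (suc b))))
  (solve 4 (λ a b c d → (a :+ b) :+ (c :+ d) := (a :+ c) :+ (b :+ d)) refl (f zero) (g zero) _ _)
  where open ℚ-Solver

mass : ∀ {m} → Fin m → ℚ → Fin m → ℚ
mass zero    x zero    = x
mass zero    x (suc _) = 0ℚ
mass (suc _) x zero    = 0ℚ
mass (suc i) x (suc b) = mass i x b

mass-≢ : ∀ {m} (i b : Fin m) x → b ≢ i → mass i x b ≡ 0ℚ
mass-≢ zero    zero    x b≢i = ⊥-elim (b≢i refl)
mass-≢ zero    (suc b) x b≢i = refl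
mass-≢ (suc i) zero    x b≢i = refl
mass-≢ (suc i) (suc b) x b≢i = mass-≢ i b x (b≢i ∘ cong suc)

mass-nonneg : ∀ {m} (i b : Fin m) {x} → 0ℚ ℚ.≤ x → 0ℚ ℚ.≤ mass i x b
mass-nonneg zero    zero    0≤x = 0≤x
mass-nonneg zero    (suc b) 0≤x = ℚ.≤-refl
mass-nonneg (suc i) zero    0≤x = ℚ.≤-refl
mass-nonneg (suc i) (suc b) 0≤x = mass-nonneg i b 0≤x

sumℚ-0* : ∀ {m} (y : Fin m → ℚ) → sumℚ (λ b → 0ℚ ℚ.* y b) ≡ 0ℚ
sumℚ-0* {zero}  y = refl
sumℚ-0* {suc m} y = trans (cong₂ ℚ._+_ (ℚ.*-zeroˡ (y zero)) (sumℚ-0* (λ b → y (suc b)))) (ℚ.+-identityˡ 0ℚ)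

sumℚ-mass-* : ∀ {m} (i : Fin m) x (y : Fin m → ℚ) → sumℚ (λ b → mass i x b ℚ.* y b) ≡ x ℚ.* y i
sumℚ-mass-* zero    x y = trans (cong (x ℚ.* y zero ℚ.+_) (sumℚ-0* (λ b → y (suc b)))) (ℚ.+-identityʳ _)
sumℚ-mass-* (suc i) x y = trans (cong (ℚ._+ sumℚ (λ b → mass i x b ℚ.* y (suc b))) (ℚ.*-zeroˡ (y zero)))
  (trans (ℚ.+-identityˡ _) (sumℚ-mass-* i x (λ b → y (suc b))))

inHullExcept-triangle : ∀ {m} (Q : Fin m → Point) {a i j k : Fin m} → a ≢ i → a ≢ j → a ≢ k →
  0ℚ ℚ.< orient (Q i) (Q j) (Q k) → 0ℚ ℚ.≤ orient (Q a) (Q j) (Q k) →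
  0ℚ ℚ.≤ orient (Q i) (Q a) (Q k) → 0ℚ ℚ.≤ orient (Q i) (Q j) (Q a) → InHullExcept Q a (Q a)
inHullExcept-triangle {m} Q {a} {i} {j} {k} a≢i a≢j a≢k 0<D 0≤α 0≤β 0≤γ =
  coefficient , coefficient-a , coefficient-nonneg , coefficient-sum ,
  coordinate proj₁ barycentric-x , coordinate proj₂ barycentric-y
  where
  open ≡-Reasoning
  D α β γ : ℚ
  D = orient (Q i) (Q j) (Q k)
  α = orient (Q a) (Q j) (Q k)
  β = orient (Q i) (Q a) (Q k)
  γ = orient (Q i) (Q j) (Q a)
  instance
    D-positive : ℚ.Positive D
    D-positive = ℚ.positive 0<D
    D-nonZero : ℚ.NonZero D
    D-nonZero = ℚ.pos⇒nonZero D
  D⁻¹ : ℚ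
  D⁻¹ = ℚ.1/ D
  instance
    D⁻¹-nonNeg : ℚ.NonNegative D⁻¹
    D⁻¹-nonNeg = ℚ.pos⇒nonNeg D⁻¹ {{ℚ.1/pos⇒pos D}}

  scaled-nonneg : ∀ {x} → 0ℚ ℚ.≤ x → 0ℚ ℚ.≤ x ℚ.* D⁻¹
  scaled-nonneg {x} 0≤x = subst (ℚ._≤ x ℚ.* D⁻¹) (ℚ.*-zeroˡ D⁻¹) (ℚ.*-monoʳ-≤-nonNeg D⁻¹ 0≤x)

  coefficient : Fin m → ℚ
  coefficient b = mass i (α ℚ.* D⁻¹) b ℚ.+ mass j (β ℚ.* D⁻¹) b ℚ.+ mass k (γ ℚ.* D⁻¹) b

  coefficient-a : coefficient a ≡ 0ℚ
  coefficient-a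
    rewrite mass-≢ i a (α ℚ.* D⁻¹) a≢i | mass-≢ j a (β ℚ.* D⁻¹) a≢j | mass-≢ k a (γ ℚ.* D⁻¹) a≢k = refl

  coefficient-nonneg : ∀ b → 0ℚ ℚ.≤ coefficient b
  coefficient-nonneg b = ℚ.+-mono-≤ {0ℚ} {_} {0ℚ}
    (ℚ.+-mono-≤ {0ℚ} {_} {0ℚ} (mass-nonneg i b (scaled-nonneg 0≤α)) (mass-nonneg j b (scaled-nonneg 0≤β)))
    (mass-nonneg k b (scaled-nonneg 0≤γ))

  combination : ∀ (y : Fin m → ℚ) →
    sumℚ (λ b → coefficient b ℚ.* y b) ≡ (α ℚ.* y i ℚ.+ β ℚ.* y j ℚ.+ γ ℚ.* y k) ℚ.* D⁻¹
  combination y = begin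
    sumℚ (λ b → coefficient b ℚ.* y b)
      ≡⟨ sumℚ-cong (λ b → solve 4 (λ p q r x → (p :+ q :+ r) :* x := p :* x :+ q :* x :+ r :* x)
                             refl (mass i (α ℚ.* D⁻¹) b) (mass j (β ℚ.* D⁻¹) b) (mass k (γ ℚ.* D⁻¹) b) (y b)) ⟩
    sumℚ (λ b → yᵢ b ℚ.+ yⱼ b ℚ.+ yₖ b)
      ≡⟨ trans (sumℚ-+ (λ b → yᵢ b ℚ.+ yⱼ b) yₖ) (cong (ℚ._+ sumℚ yₖ) (sumℚ-+ yᵢ yⱼ)) ⟩
    sumℚ yᵢ ℚ.+ sumℚ yⱼ ℚ.+ sumℚ yₖ
      ≡⟨ cong₂ ℚ._+_ (cong₂ ℚ._+_ (sumℚ-mass-* i _ y) (sumℚ-mass-* j _ y)) (sumℚ-mass-* k _ y) ⟩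
    α ℚ.* D⁻¹ ℚ.* y i ℚ.+ β ℚ.* D⁻¹ ℚ.* y j ℚ.+ γ ℚ.* D⁻¹ ℚ.* y k
      ≡⟨ solve 7 (λ α β γ r x y z → α :* r :* x :+ β :* r :* y :+ γ :* r :* z := (α :* x :+ β :* y :+ γ :* z) :* r)
           refl α β γ D⁻¹ (y i) (y j) (y k) ⟩
    (α ℚ.* y i ℚ.+ β ℚ.* y j ℚ.+ γ ℚ.* y k) ℚ.* D⁻¹ ∎
    where
    open ℚ-Solver
    yᵢ yⱼ yₖ : Fin m → ℚ
    yᵢ b = mass i (α ℚ.* D⁻¹) b ℚ.* y b
    yⱼ b = mass j (β ℚ.* D⁻¹) b ℚ.* y b
    yₖ b = mass k (γ ℚ.* D⁻¹) b ℚ.* y b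

  coefficient-sum : sumℚ coefficient ≡ 1ℚ
  coefficient-sum = begin
    sumℚ coefficient
      ≡⟨ sumℚ-cong (λ b → sym (ℚ.*-identityʳ (coefficient b))) ⟩
    sumℚ (λ b → coefficient b ℚ.* 1ℚ)
      ≡⟨ combination (λ _ → 1ℚ) ⟩
    (α ℚ.* 1ℚ ℚ.+ β ℚ.* 1ℚ ℚ.+ γ ℚ.* 1ℚ) ℚ.* D⁻¹
      ≡⟨ cong (ℚ._* D⁻¹) (solve 3 (λ α β γ → α :* con 1ℚ :+ β :* con 1ℚ :+ γ :* con 1ℚ := α :+ β :+ γ) refl α β γ) ⟩
    (α ℚ.+ β ℚ.+ γ) ℚ.* D⁻¹
      ≡⟨ cong (ℚ._* D⁻¹) (barycentric-weight (Q i) (Q j) (Q k) (Q a)) ⟩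
    D ℚ.* D⁻¹
      ≡⟨ ℚ.*-inverseʳ D ⟩
    1ℚ ∎
    where open ℚ-Solver

  coordinate : (π : Point → ℚ) →
    (∀ p q r x → orient x q r ℚ.* π p ℚ.+ orient p x r ℚ.* π q ℚ.+ orient p q x ℚ.* π r ≡ orient p q r ℚ.* π x) →
    sumℚ (λ b → coefficient b ℚ.* π (Q b)) ≡ π (Q a)
  coordinate π barycentric-π = begin
    sumℚ (λ b → coefficient b ℚ.* π (Q b))  ≡⟨ combination (λ b → π (Q b)) ⟩
    (α ℚ.* π (Q i) ℚ.+ β ℚ.* π (Q j) ℚ.+ γ ℚ.* π (Q k)) ℚ.* D⁻¹
                                       ≡⟨ cong (ℚ._* D⁻¹) (barycentric-π (Q i) (Q j) (Q k) (Q a)) ⟩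
    D ℚ.* π (Q a) ℚ.* D⁻¹               ≡⟨ solve 3 (λ d x r → d :* x :* r := x :* (d :* r)) refl D (π (Q a)) D⁻¹ ⟩
    π (Q a) ℚ.* (D ℚ.* D⁻¹)             ≡⟨ cong (π (Q a) ℚ.*_) (ℚ.*-inverseʳ D) ⟩
    π (Q a) ℚ.* 1ℚ                      ≡⟨ ℚ.*-identityʳ (π (Q a)) ⟩
    π (Q a)                             ∎
    where open ℚ-Solver

collinear-swap : ∀ p q r → Collinear p q r → Collinear p r q
collinear-swap p q r col = trans (orient-swap p q r) (cong ℚ.-_ col)

collinear-rotate : ∀ p q r → Collinear p q r → Collinear q r p
collinear-rotate p q r col = trans (orient-rotate p q r) col

module _ {N} (P : Fin N → Point) where
  private
    swap : ∀ a b c → Collinear (P a) (P b) (P c) → Collinear (P a) (P c) (P b)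
    swap a b c = collinear-swap (P a) (P b) (P c)

    rotate : ∀ a b c → Collinear (P a) (P b) (P c) → Collinear (P b) (P c) (P a)
    rotate a b c = collinear-rotate (P a) (P b) (P c)

  generalPosition-sorted :
    (∀ {i j k} → i Fin.< j → j Fin.< k → ¬ Collinear (P i) (P j) (P k)) → GeneralPosition P
  generalPosition-sorted sorted i j k i≢j j≢k i≢k col
    with Fin.<-cmp i j | Fin.<-cmp j k | Fin.<-cmp i k
  ... | tri≈ _ i≡j _ | _ | _ = i≢j i≡j
  ... | _ | tri≈ _ j≡k _ | _ = j≢k j≡k
  ... | _ | _ | tri≈ _ i≡k _ = i≢k i≡k
  ... | tri< i<j _ _ | tri< j<k _ _ | _            = sorted i<j j<k col
  ... | tri< i<j _ _ | tri> _ _ k<j | tri< i<k _ _ = sorted i<k k<j (swap i j k col)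
  ... | tri< i<j _ _ | tri> _ _ k<j | tri> _ _ k<i = sorted k<i i<j (rotate j k i (rotate i j k col))
  ... | tri> _ _ j<i | tri< j<k _ _ | tri< i<k _ _ = sorted j<i i<k (swap j k i (rotate i j k col))
  ... | tri> _ _ j<i | tri< j<k _ _ | tri> _ _ k<i = sorted j<k k<i (rotate i j k col)
  ... | tri> _ _ j<i | tri> _ _ k<j | _            = sorted k<j j<i (rotate i k j (swap i j k col))

point : ℕ → ℕ → Point
point k a = toℚ a , toℚ (height k a)

orient-point : ∀ k a u w → orient (point k a) (point k (a + u)) (point k (a + u + w)) ≡
                           toℚ (chord k a u w) ℚ.- toℚ (middle k a u w)
orient-point k a u w
  rewrite toℚ-+ (a + u) w | toℚ-+ a u | toℚ-+ (u * height k (a + u + w)) (w * height k a)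
        | toℚ-* u (height k (a + u + w)) | toℚ-* w (height k a) | toℚ-* (u + w) (height k (a + u)) | toℚ-+ u w =
  solve 6 (λ a u w hᵃ hᵇ hᶜ →
    ((a :+ u :- a) :* (hᶜ :- hᵃ)) :- ((hᵇ :- hᵃ) :* (a :+ u :+ w :- a))
    := u :* hᶜ :+ w :* hᵃ :- (u :+ w) :* hᵇ)
    refl (toℚ a) (toℚ u) (toℚ w) (toℚ (height k a)) (toℚ (height k (a + u))) (toℚ (height k (a + u + w)))
  where open ℚ-Solver

private
  p<q⇒0<q-p : ∀ {p q} → p ℚ.< q → 0ℚ ℚ.< q ℚ.- p
  p<q⇒0<q-p {p} {q} p<q = subst (ℚ._< q ℚ.- p) (ℚ.+-inverseʳ p) (ℚ.+-monoˡ-< (ℚ.- p) p<q)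

  p<q⇒p-q<0 : ∀ {p q} → p ℚ.< q → p ℚ.- q ℚ.< 0ℚ
  p<q⇒p-q<0 {p} {q} p<q = subst (p ℚ.- q ℚ.<_) (ℚ.+-inverseʳ q) (ℚ.+-monoˡ-< (ℚ.- q) p<q)

  m<m+n⇒0<n : ∀ {a u} → a < a + u → 0 < u
  m<m+n⇒0<n {a} {u} a<a+u = +-cancelˡ-< a 0 u (subst (_< a + u) (sym (+-identityʳ a)) a<a+u)

orient-point-pos : ∀ k {a b c} → a < b → b < c → c < 2 ^ k →
  level k a b < level k b c → 0ℚ ℚ.< orient (point k a) (point k b) (point k c)
orient-point-pos k {a} a<b b<c c< lv with m≤n⇒∃[o]m+o≡n (<⇒≤ a<b) | m≤n⇒∃[o]m+o≡n (<⇒≤ b<c)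
... | u , refl | w , refl = subst (0ℚ ℚ.<_) (sym (orient-point k a u w))
  (p<q⇒0<q-p (toℚ-< (middle<chord k a u w (m<m+n⇒0<n a<b) (m<m+n⇒0<n b<c) c< lv)))

orient-point-neg : ∀ k {a b c} → a < b → b < c → c < 2 ^ k →
  level k b c < level k a b → orient (point k a) (point k b) (point k c) ℚ.< 0ℚ
orient-point-neg k {a} a<b b<c c< lv with m≤n⇒∃[o]m+o≡n (<⇒≤ a<b) | m≤n⇒∃[o]m+o≡n (<⇒≤ b<c)
... | u , refl | w , refl = subst (ℚ._< 0ℚ) (sym (orient-point k a u w))
  (p<q⇒p-q<0 (toℚ-< (chord<middle k a u w (m<m+n⇒0<n a<b) (m<m+n⇒0<n b<c) c< lv)))

points-generalPosition : ∀ k → GeneralPosition {2 ^ k} (λ i → point k (toℕ i))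
points-generalPosition k = generalPosition-sorted (λ i → point k (toℕ i)) noncollinear
  where
  noncollinear : ∀ {i j l : Fin (2 ^ k)} → i Fin.< j → j Fin.< l →
                 ¬ Collinear (point k (toℕ i)) (point k (toℕ j)) (point k (toℕ l))
  noncollinear {i} {j} {l} i<j j<l col with <-cmp (level k (toℕ i) (toℕ j)) (level k (toℕ j) (toℕ l))
  ... | tri< lv _ _ = ℚ.<-irrefl (sym col) (orient-point-pos k i<j j<l (Fin.toℕ<n l) lv)
  ... | tri≈ _ lv _ = proj₁ (level-ultrametric k _ _ _ i<j j<l (Fin.toℕ<n l)) lv
  ... | tri> _ _ lv = ℚ.<-irrefl col (orient-point-neg k i<j j<l (Fin.toℕ<n l) lv)

PartialAssignment : Set
PartialAssignment = ℕ → Maybe Bool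

shift : PartialAssignment → PartialAssignment
shift ρ i = ρ (suc i)

unfixedAt : Maybe Bool → ℕ
unfixedAt nothing  = 1
unfixedAt (just _) = 0

unfixed : ℕ → PartialAssignment → ℕ
unfixed zero    ρ = 0
unfixed (suc P) ρ = unfixedAt (ρ zero) + unfixed P (shift ρ)

Agrees : ℕ → (ℕ → Bool) → PartialAssignment → Set
Agrees P v ρ = ∀ i → i < P → ∀ b → ρ i ≡ just b → v i ≡ b

-- the number of assignments of P bits agreeing with a member of ρs, counted with multiplicity
weight : ℕ → List PartialAssignment → ℕ
weight P []       = 0
weight P (ρ ∷ ρs) = 2 ^ unfixed P ρ + weight P ρs

compatible : Bool → Maybe Bool → Bool
compatible _     nothing  = true
compatible true  (just b) = b
compatible false (just b) = not b

condition : Bool → List PartialAssignment → List PartialAssignment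
condition b []       = []
condition b (ρ ∷ ρs) = if compatible b (ρ zero) then shift ρ ∷ condition b ρs else condition b ρs

module _ (P : ℕ) (ρ : PartialAssignment) where

  share : Bool → ℕ
  share b = if compatible b (ρ zero) then 2 ^ unfixed P (shift ρ) else 0

  weight-condition-∷ : ∀ b ρs → weight P (condition b (ρ ∷ ρs)) ≡ share b + weight P (condition b ρs)
  weight-condition-∷ b ρs with compatible b (ρ zero)
  ... | true  = refl
  ... | false = refl

  share-true+share-false : share true + share false ≡ 2 ^ unfixed (suc P) ρ
  share-true+share-false with ρ zero
  ... | nothing    = cong (2 ^ unfixed P (shift ρ) +_) (sym (+-identityʳ (2 ^ unfixed P (shift ρ))))
  ... | just true  = +-identityʳ (2 ^ unfixed P (shift ρ))
  ... | just false = refl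

weight-condition : ∀ P ρs → weight P (condition true ρs) + weight P (condition false ρs) ≡ weight (suc P) ρs
weight-condition P []       = refl
weight-condition P (ρ ∷ ρs) = begin
  weight P (condition true (ρ ∷ ρs)) + weight P (condition false (ρ ∷ ρs))
    ≡⟨ cong₂ _+_ (weight-condition-∷ P ρ true ρs) (weight-condition-∷ P ρ false ρs) ⟩
  (share P ρ true + weight P (condition true ρs)) + (share P ρ false + weight P (condition false ρs))
    ≡⟨ +-interchange (share P ρ true) _ (share P ρ false) _ ⟩
  (share P ρ true + share P ρ false) + (weight P (condition true ρs) + weight P (condition false ρs))
    ≡⟨ cong₂ _+_ (share-true+share-false P ρ) (weight-condition P ρs) ⟩
  2 ^ unfixed (suc P) ρ + weight (suc P) ρs ∎
  where open ≡-Reasoning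

cons : Bool → (ℕ → Bool) → ℕ → Bool
cons b v zero    = b
cons b v (suc i) = v i

module _ {P : ℕ} {b : Bool} {v : ℕ → Bool} {ρ : PartialAssignment} (agrees : Agrees (suc P) (cons b v) ρ) where

  agrees-shift : Agrees P v (shift ρ)
  agrees-shift i i<P = agrees (suc i) (s≤s i<P)

  agrees-compatible : compatible b (ρ zero) ≡ true
  agrees-compatible with ρ zero in ρ₀
  ... | nothing = refl
  ... | just b′ with agrees zero z<s b′ ρ₀
  ...   | refl = compatible-self b
    where
    compatible-self : ∀ b → compatible b (just b) ≡ true
    compatible-self true  = refl
    compatible-self false = refl

disagree-condition : ∀ P b v ρs → All (¬_ ∘ Agrees P v) (condition b ρs) → All (¬_ ∘ Agrees (suc P) (cons b v)) ρs
disagree-condition P b v []       _ = []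
disagree-condition P b v (ρ ∷ ρs) h with compatible b (ρ zero) in compat
disagree-condition P b v (ρ ∷ ρs) (disagree ∷ h) | true =
  (disagree ∘ agrees-shift) ∷ disagree-condition P b v ρs h
disagree-condition P b v (ρ ∷ ρs) h | false =
  (λ agrees → case trans (sym compat) (agrees-compatible agrees) of λ ()) ∷ disagree-condition P b v ρs h

-- Method of conditional expectations: by weight-condition, one of the two values of the first
-- bit keeps the weight of the remaining constraints below 2 ^ P.
avoid : ∀ P ρs → weight P ρs < 2 ^ P → Σ (ℕ → Bool) λ v → All (¬_ ∘ Agrees P v) ρs
avoid zero    []       _ = (λ _ → false) , []
avoid zero    (ρ ∷ ρs) (s≤s ())
avoid (suc P) ρs w< with weight P (condition true ρs) <? 2 ^ P
... | yes w₁< = let (v , h) = avoid P (condition true ρs) w₁< in cons true v , disagree-condition P true v ρs h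
... | no w₁≮ = let (v , h) = avoid P (condition false ρs) w₀< in cons false v , disagree-condition P false v ρs h
  where
  w₀< : weight P (condition false ρs) < 2 ^ P
  w₀< = +-cancelˡ-< (2 ^ P) _ _ (begin-strict
    2 ^ P + weight P (condition false ρs)                          ≤⟨ +-monoˡ-≤ _ (≮⇒≥ w₁≮) ⟩
    weight P (condition true ρs) + weight P (condition false ρs)   ≡⟨ weight-condition P ρs ⟩
    weight (suc P) ρs                                              <⟨ w< ⟩
    2 ^ suc P                                                      ≡⟨ 2^suc P ⟩
    2 ^ P + 2 ^ P                                                  ∎)
    where open ≤-Reasoning

fixAll : Bool → List ℕ → PartialAssignment
fixAll c []       i = nothing
fixAll c (k ∷ ks) i with i ≟ k
... | yes _ = just c
... | no _  = fixAll c ks i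

fixAll-just : ∀ c ks i b → fixAll c ks i ≡ just b → i ∈ ks × b ≡ c
fixAll-just c (k ∷ ks) i b eq with i ≟ k
fixAll-just c (k ∷ ks) i b refl | yes i≡k = here i≡k , refl
... | no _ = let (i∈ks , b≡c) = fixAll-just c ks i b eq in there i∈ks , b≡c

fixAll-∉ : ∀ c k ks → All (k ≢_) ks → fixAll c ks k ≡ nothing
fixAll-∉ c k []        _           = refl
fixAll-∉ c k (k′ ∷ ks) (k≢k′ ∷ k∉) with k ≟ k′
... | yes k≡k′ = ⊥-elim (k≢k′ k≡k′)
... | no _     = fixAll-∉ c k ks k∉

unfixed-cong : ∀ P {ρ ρ′} → (∀ i → ρ i ≡ ρ′ i) → unfixed P ρ ≡ unfixed P ρ′
unfixed-cong zero    ρ≗ρ′ = refl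
unfixed-cong (suc P) ρ≗ρ′ = cong₂ _+_ (cong unfixedAt (ρ≗ρ′ zero)) (unfixed-cong P (ρ≗ρ′ ∘ suc))

unfixed-empty : ∀ P → unfixed P (λ _ → nothing) ≡ P
unfixed-empty zero    = refl
unfixed-empty (suc P) = cong suc (unfixed-empty P)

unfixed-fix : ∀ P (ρ ρ′ : PartialAssignment) k c → k < P → ρ k ≡ nothing → ρ′ k ≡ just c →
              (∀ i → i ≢ k → ρ′ i ≡ ρ i) → suc (unfixed P ρ′) ≡ unfixed P ρ
unfixed-fix (suc P) ρ ρ′ zero c _ ρk ρ′k same rewrite ρk | ρ′k =
  cong suc (unfixed-cong P (λ i → same (suc i) λ ()))
unfixed-fix (suc P) ρ ρ′ (suc k) c (s≤s k<P) ρk ρ′k same rewrite same zero (λ ()) =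
  trans (sym (+-suc (unfixedAt (ρ zero)) _))
    (cong (unfixedAt (ρ zero) +_)
      (unfixed-fix P (shift ρ) (shift ρ′) k c k<P ρk ρ′k (λ i i≢k → same (suc i) (i≢k ∘ suc-injective))))

unfixed-fixAll : ∀ P c ks → AllPairs _≢_ ks → All (_< P) ks → unfixed P (fixAll c ks) + length ks ≡ P
unfixed-fixAll P c []       _            _             = trans (+-identityʳ _) (unfixed-empty P)
unfixed-fixAll P c (k ∷ ks) (k∉ks ∷ ks!) (k<P ∷ ks<P) = begin
  unfixed P (fixAll c (k ∷ ks)) + suc (length ks)   ≡⟨ +-suc _ _ ⟩
  suc (unfixed P (fixAll c (k ∷ ks))) + length ks   ≡⟨ cong (_+ length ks) (unfixed-fix P (fixAll c ks) (fixAll c (k ∷ ks)) k c k<P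
                                                          (fixAll-∉ c k ks k∉ks) fixes-k elsewhere) ⟩
  unfixed P (fixAll c ks) + length ks               ≡⟨ unfixed-fixAll P c ks ks! ks<P ⟩
  P ∎
  where
  open ≡-Reasoning
  fixes-k : fixAll c (k ∷ ks) k ≡ just c
  fixes-k with k ≟ k
  ... | yes _   = refl
  ... | no k≢k = ⊥-elim (k≢k refl)
  elsewhere : ∀ i → i ≢ k → fixAll c (k ∷ ks) i ≡ fixAll c ks i
  elsewhere i i≢k with i ≟ k
  ... | yes i≡k = ⊥-elim (i≢k i≡k)
  ... | no _    = refl

C₂ : ℕ → ℕ
C₂ zero    = 0
C₂ (suc k) = k + C₂ k

module PairCodes (M : ℕ) where

  -- the colour of a pair x > y of numbers below M is the bit at position pairCode x y
  pairCode : ℕ → ℕ → ℕ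
  pairCode x y = x * M + y

  pairCodes : List ℕ → List ℕ
  pairCodes []       = []
  pairCodes (x ∷ xs) = map (pairCode x) xs ++ pairCodes xs

  length-pairCodes : ∀ ds → length (pairCodes ds) ≡ C₂ (length ds)
  length-pairCodes []       = refl
  length-pairCodes (x ∷ xs) =
    trans (length-++ (map (pairCode x) xs)) (cong₂ _+_ (length-map (pairCode x) xs) (length-pairCodes xs))

  pairCode-< : ∀ {t x y} → t ≤ M → x < t → y < x → pairCode x y < t * M
  pairCode-< {t} {x} {y} t≤M x<t y<x = begin-strict
    x * M + y   <⟨ +-monoʳ-< (x * M) (<-≤-trans y<x (≤-trans (<⇒≤ x<t) t≤M)) ⟩
    x * M + M   ≡⟨ +-comm (x * M) M ⟩
    suc x * M   ≤⟨ *-monoˡ-≤ M x<t ⟩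
    t * M       ∎
    where open ≤-Reasoning

  pairCodes-< : ∀ t ds → t ≤ M → AllPairs _>_ ds → All (_< t) ds → All (_< t * M) (pairCodes ds)
  pairCodes-< t []       _   _            _           = []
  pairCodes-< t (x ∷ xs) t≤M (x>xs ∷ xs↓) (x<t ∷ xs<t) =
    All.++⁺ (All.map⁺ (All.map (pairCode-< t≤M x<t) x>xs)) (pairCodes-< t xs t≤M xs↓ xs<t)

  pairCodes-unique : ∀ ds → AllPairs _>_ ds → All (_< M) ds → AllPairs _≢_ (pairCodes ds)
  pairCodes-unique []       _            _           = []
  pairCodes-unique (x ∷ xs) (x>xs ∷ xs↓) (x<M ∷ xs<M) =
    AllPairs.++⁺ (AllPairs.map⁺ (AllPairs.map (injective ∘ >⇒≢) xs↓))
                 (pairCodes-unique xs xs↓ xs<M)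
                 (All.map⁺ (All.map (λ {y} _ → All.map (above y) below) x>xs))
    where
    injective : ∀ {y z} → y ≢ z → pairCode x y ≢ pairCode x z
    injective y≢z eq = y≢z (+-cancelˡ-≡ (x * M) _ _ eq)
    above : ∀ y {k} → k < x * M → pairCode x y ≢ k
    above y k< eq = <-irrefl (sym eq) (<-≤-trans k< (m≤m+n (x * M) y))
    below : All (_< x * M) (pairCodes xs)
    below = pairCodes-< x xs (<⇒≤ x<M) xs↓ x>xs

  homogeneous-pairCodes : ∀ (v : ℕ → Bool) c ds → AllPairs (λ x y → v (pairCode x y) ≡ c) ds →
                          All (λ i → v i ≡ c) (pairCodes ds)
  homogeneous-pairCodes v c []       _          = []
  homogeneous-pairCodes v c (x ∷ xs) (hx ∷ hxs) = All.++⁺ (All.map⁺ hx) (homogeneous-pairCodes v c xs hxs)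

  agrees-fixAll : ∀ (v : ℕ → Bool) c P ds → AllPairs (λ x y → v (pairCode x y) ≡ c) ds →
                  Agrees P v (fixAll c (pairCodes ds))
  agrees-fixAll v c P ds hom i _ b fixed with fixAll-just c (pairCodes ds) i b fixed
  ... | i∈ , refl = All.lookup (homogeneous-pairCodes v c ds hom) i∈

Homogeneous : {C : Set} → (ℕ → ℕ → C) → C → List ℕ → Set
Homogeneous colour c ds = AllPairs (λ x y → colour x y ≡ c) ds

Combination : ℕ → ℕ → List ℕ → Set
Combination M k ds = length ds ≡ k × AllPairs _>_ ds × All (_< M) ds

combinations : ℕ → ℕ → List (List ℕ)
combinations M       zero    = [] ∷ []
combinations zero    (suc k) = []
combinations (suc M) (suc k) = combinations M (suc k) ++ map (M ∷_) (combinations M k)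

combinations-complete : ∀ M ds → AllPairs _>_ ds → All (_< M) ds → ds ∈ combinations M (length ds)
combinations-complete M       []       _            _           = here refl
combinations-complete zero    (x ∷ xs) _            (() ∷ _)
combinations-complete (suc M) (x ∷ xs) (x>xs ∷ xs↓) (x<1+M ∷ xs<) with m<1+n⇒m<n∨m≡n x<1+M
... | inj₂ refl = ∈-++⁺ʳ (combinations x (suc (length xs))) (∈-map⁺ (x ∷_) (combinations-complete x xs xs↓ x>xs))
... | inj₁ x<M  = ∈-++⁺ˡ (combinations-complete M (x ∷ xs) (x>xs ∷ xs↓) (x<M ∷ All.map (λ y<x → <-trans y<x x<M) x>xs))

combinations-sound : ∀ M k → All (Combination M k) (combinations M k)
combinations-sound M       zero    = (refl , [] , []) ∷ []
combinations-sound zero    (suc k) = []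
combinations-sound (suc M) (suc k) =
  All.++⁺ (All.map widen (combinations-sound M (suc k))) (All.map⁺ (All.map extend (combinations-sound M k)))
  where
  widen : ∀ {ds} → Combination M (suc k) ds → Combination (suc M) (suc k) ds
  widen (len , ds↓ , ds<M) = len , ds↓ , All.map m<n⇒m<1+n ds<M
  extend : ∀ {ds} → Combination M k ds → Combination (suc M) (suc k) (M ∷ ds)
  extend (len , ds↓ , ds<M) = cong suc len , ds<M ∷ ds↓ , ≤-refl ∷ All.map m<n⇒m<1+n ds<M

length-combinations-suc : ∀ M k →
  length (combinations (suc M) (suc k)) ≡ length (combinations M (suc k)) + length (combinations M k)
length-combinations-suc M k =
  trans (length-++ (combinations M (suc k))) (cong (length (combinations M (suc k)) +_) (length-map (M ∷_) (combinations M k)))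

binomial-lower-bound : ∀ M k → M ^ suc k + suc k * M ^ k ≤ suc M ^ suc k
binomial-lower-bound M zero    = ≤-reflexive (solve 1 (λ M → M :* con 1 :+ con 1 :* con 1 := (con 1 :+ M) :* con 1) refl M)
  where open ℕ-Solver
binomial-lower-bound M (suc k) = begin
  M ^ suc (suc k) + suc (suc k) * M ^ suc k
    ≤⟨ m≤m+n _ (suc k * M ^ k) ⟩
  M * (M * M ^ k) + (2 + k) * (M * M ^ k) + suc k * M ^ k
    ≡⟨ solve 3 (λ M k a → M :* (M :* a) :+ (con 2 :+ k) :* (M :* a) :+ (con 1 :+ k) :* a
                        := (con 1 :+ M) :* (M :* a :+ (con 1 :+ k) :* a)) refl M k (M ^ k) ⟩
  suc M * (M ^ suc k + suc k * M ^ k)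
    ≤⟨ *-monoʳ-≤ (suc M) (binomial-lower-bound M k) ⟩
  suc M ^ suc (suc k) ∎
  where open ≤-Reasoning; open ℕ-Solver

length-combinations : ∀ M k → length (combinations M k) * k ! ≤ M ^ k
length-combinations M       zero    = ≤-refl
length-combinations zero    (suc k) = z≤n
length-combinations (suc M) (suc k) = begin
  length (combinations (suc M) (suc k)) * suc k !
    ≡⟨ cong (_* suc k !) (length-combinations-suc M k) ⟩
  (a + b) * (suc k * k !)
    ≡⟨ solve 4 (λ a b k f → (a :+ b) :* ((con 1 :+ k) :* f) := a :* ((con 1 :+ k) :* f) :+ (con 1 :+ k) :* (b :* f))
         refl a b k (k !) ⟩
  a * suc k ! + suc k * (b * k !)
    ≤⟨ +-mono-≤ (length-combinations M (suc k)) (*-monoʳ-≤ (suc k) (length-combinations M k)) ⟩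
  M ^ suc k + suc k * M ^ k
    ≤⟨ binomial-lower-bound M k ⟩
  suc M ^ suc k ∎
  where
  open ≤-Reasoning; open ℕ-Solver
  a b : ℕ
  a = length (combinations M (suc k))
  b = length (combinations M k)

2^n≤n! : ∀ n → 4 ≤ n → 2 ^ n ≤ n !
2^n≤n! n 4≤n with m≤n⇒∃[o]m+o≡n 4≤n
... | d , refl = go d
  where
  go : ∀ d → 2 ^ (4 + d) ≤ (4 + d) !
  go zero    = ≤ᵇ⇒≤ 16 24 tt
  go (suc d) = *-mono-≤ (s≤s (s≤s (z≤n {3 + d}))) (go d)

2*C₂+n≡n*n : ∀ n → 2 * C₂ n + n ≡ n * n
2*C₂+n≡n*n zero    = refl
2*C₂+n≡n*n (suc k) = begin
  2 * (k + C₂ k) + suc k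
    ≡⟨ solve 2 (λ k c → con 2 :* (k :+ c) :+ (con 1 :+ k) := (con 2 :* c :+ k) :+ (k :+ k :+ con 1)) refl k (C₂ k) ⟩
  (2 * C₂ k + k) + (k + k + 1)
    ≡⟨ cong (_+ (k + k + 1)) (2*C₂+n≡n*n k) ⟩
  k * k + (k + k + 1)
    ≡⟨ solve 1 (λ k → k :* k :+ (k :+ k :+ con 1) := (con 1 :+ k) :* (con 1 :+ k)) refl k ⟩
  suc k * suc k ∎
  where open ≡-Reasoning; open ℕ-Solver

few-combinations : ∀ h n → 2 * h ≤ n → 4 ≤ n → 2 * length (combinations (2 ^ h) n) < 2 ^ C₂ n
few-combinations h n 2h≤n 4≤n = *-cancelʳ-< (2 ^ n) _ _ (begin-strict
  2 * L * 2 ^ n       ≤⟨ *-monoʳ-≤ (2 * L) (2^n≤n! n 4≤n) ⟩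
  2 * L * n !         ≡⟨ *-assoc 2 L (n !) ⟩
  2 * (L * n !)       ≤⟨ *-monoʳ-≤ 2 (length-combinations (2 ^ h) n) ⟩
  2 * (2 ^ h) ^ n     ≡⟨ cong (2 *_) (^-*-assoc 2 h n) ⟩
  2 ^ suc (h * n)     <⟨ ^-monoʳ-< 2 (s≤s (s≤s z≤n)) exponent< ⟩
  2 ^ (C₂ n + n)      ≡⟨ ^-distribˡ-+-* 2 (C₂ n) n ⟩
  2 ^ C₂ n * 2 ^ n    ∎)
  where
  open ≤-Reasoning
  L : ℕ
  L = length (combinations (2 ^ h) n)
  exponent< : suc (h * n) < C₂ n + n
  exponent< = *-cancelˡ-< 2 _ _ (begin-strict
    2 * suc (h * n)   ≡⟨ solve 2 (λ h n → con 2 :* (con 1 :+ h :* n) := con 2 :* h :* n :+ con 2) refl h n ⟩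
    2 * h * n + 2     ≤⟨ +-monoˡ-≤ 2 (*-monoˡ-≤ n 2h≤n) ⟩
    n * n + 2         <⟨ +-monoʳ-< (n * n) (<-≤-trans (s≤s (s≤s (s≤s z≤n))) 4≤n) ⟩
    n * n + n         ≡⟨ cong (_+ n) (2*C₂+n≡n*n n) ⟨
    2 * C₂ n + n + n  ≡⟨ solve 2 (λ c n → con 2 :* c :+ n :+ n := con 2 :* (c :+ n)) refl (C₂ n) n ⟩
    2 * (C₂ n + n)    ∎)
    where open ℕ-Solver

module MonochromaticPatterns (M n : ℕ) where
  open PairCodes M

  P : ℕ
  P = M * M

  patterns : List (List ℕ) → List PartialAssignment
  patterns []         = []
  patterns (ds ∷ dss) = fixAll true (pairCodes ds) ∷ fixAll false (pairCodes ds) ∷ patterns dss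

  patterns-lookup : ∀ {Q : PartialAssignment → Set} dss → All Q (patterns dss) →
                    ∀ {ds} → ds ∈ dss → ∀ c → Q (fixAll c (pairCodes ds))
  patterns-lookup (ds ∷ dss) (q₁ ∷ q₀ ∷ _)  (here refl) true  = q₁
  patterns-lookup (ds ∷ dss) (q₁ ∷ q₀ ∷ _)  (here refl) false = q₀
  patterns-lookup (ds ∷ dss) (_ ∷ _ ∷ qs) (there ds∈) c     = patterns-lookup dss qs ds∈ c

  weight-pattern : ∀ ds c → Combination M n ds → 2 ^ unfixed P (fixAll c (pairCodes ds)) * 2 ^ C₂ n ≡ 2 ^ P
  weight-pattern ds c (len , ds↓ , ds<M) = begin
    2 ^ u * 2 ^ C₂ n                   ≡⟨ ^-distribˡ-+-* 2 u (C₂ n) ⟨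
    2 ^ (u + C₂ n)                     ≡⟨ cong (λ k → 2 ^ (u + k)) (trans (length-pairCodes ds) (cong C₂ len)) ⟨
    2 ^ (u + length (pairCodes ds))    ≡⟨ cong (2 ^_) (unfixed-fixAll P c (pairCodes ds) codes-unique codes-<) ⟩
    2 ^ P                              ∎
    where
    open ≡-Reasoning
    u : ℕ
    u = unfixed P (fixAll c (pairCodes ds))
    codes-unique : AllPairs _≢_ (pairCodes ds)
    codes-unique = pairCodes-unique ds ds↓ ds<M
    codes-< : All (_< P) (pairCodes ds)
    codes-< = pairCodes-< M ds ≤-refl ds↓ ds<M

  weight-patterns : ∀ dss → All (Combination M n) dss → weight P (patterns dss) * 2 ^ C₂ n ≡ 2 * length dss * 2 ^ P
  weight-patterns []         []       = refl
  weight-patterns (ds ∷ dss) (ds✓ ∷ dss✓) = begin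
    (w₁ + (w₀ + weight P (patterns dss))) * X
      ≡⟨ solve 4 (λ a b w x → (a :+ (b :+ w)) :* x := a :* x :+ (b :* x :+ w :* x))
           refl w₁ w₀ (weight P (patterns dss)) X ⟩
    w₁ * X + (w₀ * X + weight P (patterns dss) * X)
      ≡⟨ cong₂ _+_ (weight-pattern ds true ds✓)
                   (cong₂ _+_ (weight-pattern ds false ds✓) (weight-patterns dss dss✓)) ⟩
    2 ^ P + (2 ^ P + 2 * length dss * 2 ^ P)
      ≡⟨ solve 2 (λ q l → q :+ (q :+ con 2 :* l :* q) := con 2 :* (con 1 :+ l) :* q) refl (2 ^ P) (length dss) ⟩
    2 * suc (length dss) * 2 ^ P ∎
    where
    open ≡-Reasoning; open ℕ-Solver
    w₁ w₀ X : ℕ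
    w₁ = 2 ^ unfixed P (fixAll true (pairCodes ds))
    w₀ = 2 ^ unfixed P (fixAll false (pairCodes ds))
    X = 2 ^ C₂ n

-- Erdős's bound, derandomised: the 2 · C(2 ^ h, n) monochromatic patterns of n-sets have total
-- weight below 2 ^ P, so some colouring of the P bits avoids all of them.
ramsey-lower-bound : ∀ h n → 2 * h ≤ n → 4 ≤ n →
  Σ (ℕ → ℕ → Fin 2) λ colour → ∀ c ds → Combination (2 ^ h) n ds → ¬ Homogeneous colour c ds
ramsey-lower-bound h n 2h≤n 4≤n = colour , no-homogeneous
  where
  M : ℕ
  M = 2 ^ h
  open PairCodes M
  open MonochromaticPatterns M n
  weight< : weight P (patterns (combinations M n)) < 2 ^ P
  weight< = *-cancelʳ-< (2 ^ C₂ n) _ _ (begin-strict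
    weight P (patterns (combinations M n)) * 2 ^ C₂ n  ≡⟨ weight-patterns (combinations M n) (combinations-sound M n) ⟩
    2 * length (combinations M n) * 2 ^ P              <⟨ *-monoˡ-< (2 ^ P) {{m^n≢0 2 P}} (few-combinations h n 2h≤n 4≤n) ⟩
    2 ^ C₂ n * 2 ^ P                                   ≡⟨ *-comm (2 ^ C₂ n) (2 ^ P) ⟩
    2 ^ P * 2 ^ C₂ n                                   ∎)
    where open ≤-Reasoning
  v : ℕ → Bool
  v = proj₁ (avoid P (patterns (combinations M n)) weight<)
  colour : ℕ → ℕ → Fin 2
  colour x y = Inverse.from 2↔Bool (v (pairCode x y))
  no-homogeneous : ∀ c ds → Combination M n ds → ¬ Homogeneous colour c ds
  no-homogeneous c ds (refl , ds↓ , ds<M) hom =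
    patterns-lookup (combinations M n) (proj₂ (avoid P (patterns (combinations M n)) weight<))
      (combinations-complete M ds ds↓ ds<M) (Inverse.to 2↔Bool c)
      (agrees-fixAll v _ P ds (AllPairs.map (λ {x} {y} → bit {x} {y}) hom))
    where
    bit : ∀ {x y} → colour x y ≡ c → v (pairCode x y) ≡ Inverse.to 2↔Bool c
    bit {x} {y} eq = trans (sym (Inverse.strictlyInverseˡ 2↔Bool (v (pairCode x y)))) (cong (Inverse.to 2↔Bool) eq)

module Unimodal (e : ℕ → ℕ) (N : ℕ)
  (adjacent-distinct : ∀ t → suc t < N → e t ≢ e (suc t))
  (no-valley : ∀ t → suc (suc t) < N → e (suc t) < e t → e (suc t) < e (suc (suc t)) → ⊥) where

  descent-persists : ∀ i d → suc (i + d) < N → e (suc i) < e i → e (suc (i + d)) < e (i + d)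
  descent-persists i zero    _  desc rewrite +-identityʳ i = desc
  descent-persists i (suc d) lt desc rewrite +-suc i d
    with <-cmp (e (suc (suc (i + d)))) (e (suc (i + d)))
  ... | tri< fall _ _ = fall
  ... | tri≈ _ eq _   = ⊥-elim (adjacent-distinct (suc (i + d)) lt (sym eq))
  ... | tri> _ _ rise = ⊥-elim (no-valley (i + d) lt (descent-persists i d (<-trans (n<1+n _) lt) desc) rise)

  ascent-or-descent : ∀ m → m < N → (∀ t → t < m → e t < e (suc t)) ⊎ (Σ ℕ λ i → i < m × e (suc i) < e i)
  ascent-or-descent zero    _   = inj₁ (λ _ ())
  ascent-or-descent (suc m) m<N with ascent-or-descent m (<-trans (n<1+n m) m<N)
  ... | inj₂ (i , i<m , desc) = inj₂ (i , m<n⇒m<1+n i<m , desc)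
  ... | inj₁ asc with <-cmp (e m) (e (suc m))
  ...   | tri≈ _ eq _   = ⊥-elim (adjacent-distinct m m<N eq)
  ...   | tri> _ _ fall = inj₂ (m , n<1+n m , fall)
  ...   | tri< rise _ _ = inj₁ asc′
    where
    asc′ : ∀ t → t < suc m → e t < e (suc t)
    asc′ t t<1+m with m<1+n⇒m<n∨m≡n t<1+m
    ... | inj₁ t<m  = asc t t<m
    ... | inj₂ refl = rise

  unimodal : ∀ m → m < N → (∀ t → t < m → e t < e (suc t)) ⊎ (∀ t → m ≤ t → suc t < N → e (suc t) < e t)
  unimodal m m<N with ascent-or-descent m m<N
  ... | inj₁ asc = inj₁ asc
  ... | inj₂ (i , i<m , desc) = inj₂ descending
    where
    descending : ∀ t → m ≤ t → suc t < N → e (suc t) < e t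
    descending t m≤t t+1<N with m≤n⇒∃[o]m+o≡n (≤-trans (<⇒≤ i<m) m≤t)
    ... | d , refl = descent-persists i d t+1<N desc

module LevelSequence (K N : ℕ) (s : ℕ → ℕ)
  (s-increasing : ∀ {i j} → i < j → j ≤ N → s i < s j)
  (s-bounded : ∀ {i} → i ≤ N → s i < 2 ^ K) where

  ℓ : ℕ → ℕ → ℕ
  ℓ i j = level K (s i) (s j)

  step : ℕ → ℕ
  step i = ℓ i (suc i)

  ℓ-ultrametric : ∀ {i j k} → i < j → j < k → k ≤ N → ℓ i j ≢ ℓ j k × ℓ i k ≡ ℓ i j ⊔ ℓ j k
  ℓ-ultrametric i<j j<k k≤N =
    level-ultrametric K _ _ _ (s-increasing i<j (<⇒≤ (<-≤-trans j<k k≤N))) (s-increasing j<k k≤N) (s-bounded k≤N)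

  ℓ-join : ∀ {i j k} → i < j → j < k → k ≤ N → ℓ i k ≡ ℓ i j ⊔ ℓ j k
  ℓ-join i<j j<k k≤N = proj₂ (ℓ-ultrametric i<j j<k k≤N)

  ℓ<K : ∀ {i j} → i < j → j ≤ N → ℓ i j < K
  ℓ<K i<j j≤N = level< K _ _ (s-increasing i<j j≤N) (s-bounded j≤N)

  steps-distinct : ∀ t → suc t < N → step t ≢ step (suc t)
  steps-distinct t t+1<N = proj₁ (ℓ-ultrametric (n<1+n t) (n<1+n (suc t)) t+1<N)

  module _ {m} (ascending : ∀ t → t < m → step t < step (suc t)) where

    step-ascending : ∀ a d → suc (a + d) ≤ m → step a < step (suc (a + d))
    step-ascending a zero    a+1≤m rewrite +-identityʳ a = ascending a a+1≤m
    step-ascending a (suc d) a+d+2≤m rewrite +-suc a d =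
      <-trans (step-ascending a d (<⇒≤ a+d+2≤m)) (ascending (suc (a + d)) a+d+2≤m)

    ℓ-ascending : ∀ i d → i + d ≤ m → suc (i + d) ≤ N → ℓ i (suc (i + d)) ≡ step (i + d)
    ℓ-ascending i zero    _ _ rewrite +-identityʳ i = refl
    ℓ-ascending i (suc d) i+d+1≤m i+d+2≤N rewrite +-suc i d = begin
      ℓ i (suc (suc (i + d)))
        ≡⟨ ℓ-join (s≤s (m≤m+n i d)) (n<1+n _) i+d+2≤N ⟩
      ℓ i (suc (i + d)) ⊔ step (suc (i + d))
        ≡⟨ cong (_⊔ step (suc (i + d))) (ℓ-ascending i d (<⇒≤ i+d+1≤m) (<⇒≤ i+d+2≤N)) ⟩
      step (i + d) ⊔ step (suc (i + d))
        ≡⟨ m≤n⇒m⊔n≡n (<⇒≤ (ascending (i + d) i+d+1≤m)) ⟩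
      step (suc (i + d)) ∎
      where open ≡-Reasoning

  module _ {m} (descending : ∀ t → m ≤ t → suc t < N → step (suc t) < step t) where

    step-descending : ∀ a d → m ≤ a → suc (suc (a + d)) ≤ N → step (suc (a + d)) < step a
    step-descending a zero    m≤a a+2≤N rewrite +-identityʳ a = descending a m≤a a+2≤N
    step-descending a (suc d) m≤a a+d+3≤N rewrite +-suc a d =
      <-trans (step-descending (suc a) d (m≤n⇒m≤1+n m≤a) a+d+3≤N)
              (descending a m≤a (≤-trans (s≤s (s≤s (m≤m+n a d))) (<⇒≤ a+d+3≤N)))

    ℓ-descending : ∀ i d → m ≤ i → suc (i + d) ≤ N → ℓ i (suc (i + d)) ≡ step i
    ℓ-descending i zero    _ _ rewrite +-identityʳ i = refl
    ℓ-descending i (suc d) m≤i i+d+2≤N rewrite +-suc i d = begin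
      ℓ i (suc (suc (i + d)))
        ≡⟨ ℓ-join (n<1+n i) (s≤s (s≤s (m≤m+n i d))) i+d+2≤N ⟩
      step i ⊔ ℓ (suc i) (suc (suc (i + d)))
        ≡⟨ cong (step i ⊔_) (ℓ-descending (suc i) d (m≤n⇒m≤1+n m≤i) i+d+2≤N) ⟩
      step i ⊔ step (suc i)
        ≡⟨ m≥n⇒m⊔n≡m (<⇒≤ (descending i m≤i (≤-trans (s≤s (s≤s (m≤m+n i d))) i+d+2≤N))) ⟩
      step i ∎
      where open ≡-Reasoning

  module _ {C : Set} (colour : ℕ → ℕ → C) (c : C)
    (monochromatic : ∀ {i j k} → i < j → j < k → k ≤ N → colour (ℓ i j ⊔ ℓ j k) (ℓ i j ⊓ ℓ j k) ≡ c)
    (no-valley : ∀ t → suc (suc t) < N → step (suc t) < step t → step (suc t) < step (suc (suc t)) → ⊥) where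

    private
      colour-sorted : ∀ {x y} → y < x → colour (x ⊔ y) (x ⊓ y) ≡ colour x y
      colour-sorted y<x = cong₂ colour (m≥n⇒m⊔n≡m (<⇒≤ y<x)) (m≥n⇒m⊓n≡n (<⇒≤ y<x))

      colour-sorted′ : ∀ {x y} → y < x → colour (y ⊔ x) (y ⊓ x) ≡ colour x y
      colour-sorted′ {x} {y} y<x = trans (cong₂ colour (⊔-comm y x) (⊓-comm y x)) (colour-sorted y<x)

    ascending-chain : ∀ n' → suc n' ≤ N → (∀ t → t < n' → step t < step (suc t)) →
                      Σ (List ℕ) λ ds → Combination K (suc n') ds × Homogeneous colour c ds
    ascending-chain n' n<N ascending =
      applyDownFrom step (suc n') ,
      (length-applyDownFrom step (suc n') ,
       AllPairs.applyDownFrom⁺₁ step (suc n') step-< ,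
       All.applyDownFrom⁺₁ step (suc n') λ i<n → ℓ<K (n<1+n _) (≤-trans i<n n<N)) ,
      AllPairs.applyDownFrom⁺₁ step (suc n') homogeneous
      where
      step-< : ∀ {i j} → j < i → i < suc n' → step j < step i
      step-< j<i i<n with m≤n⇒∃[o]m+o≡n j<i
      ... | d , refl = step-ascending ascending _ d (s≤s⁻¹ i<n)

      homogeneous : ∀ {i j} → j < i → i < suc n' → colour (step i) (step j) ≡ c
      homogeneous {i} {j} j<i i<n with m≤n⇒∃[o]m+o≡n j<i
      ... | d , refl = trans (sym (colour-sorted′ (step-< j<i i<n)))
        (subst₂ (λ x y → colour (x ⊔ y) (x ⊓ y) ≡ c)
          (ℓ-ascending ascending 0 j (≤-trans (<⇒≤ j<i) (s≤s⁻¹ i<n)) (≤-trans (<-trans j<i i<n) n<N))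
          (ℓ-ascending ascending (suc j) d (s≤s⁻¹ i<n) (≤-trans i<n n<N))
          (monochromatic z<s (s≤s j<i) (≤-trans i<n n<N)))

    descending-chain : ∀ n' → n' + suc n' ≤ N → (∀ t → n' ≤ t → suc t < N → step (suc t) < step t) →
                       Σ (List ℕ) λ ds → Combination K (suc n') ds × Homogeneous colour c ds
    descending-chain n' 2n≤N descending =
      applyUpTo (λ t → step (n' + t)) (suc n') ,
      (length-applyUpTo (λ t → step (n' + t)) (suc n') ,
       AllPairs.applyUpTo⁺₁ _ (suc n') (λ i<j j<n → step-< (m≤m+n n' _) (+-monoʳ-< n' i<j) (n'+i<N j<n)) ,
       All.applyUpTo⁺₁ _ (suc n') λ i<n → ℓ<K (n<1+n _) (n'+i<N i<n)) ,
      AllPairs.applyUpTo⁺₁ _ (suc n') homogeneous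
      where
      n'+i<N : ∀ {i} → i < suc n' → n' + i < N
      n'+i<N {i} i<n = ≤-trans (subst (_≤ n' + suc n') (+-suc n' i) (+-monoʳ-≤ n' i<n)) 2n≤N

      step-< : ∀ {a b} → n' ≤ a → a < b → b < N → step b < step a
      step-< n'≤a a<b b<N with m≤n⇒∃[o]m+o≡n a<b
      ... | d , refl = step-descending descending _ d n'≤a b<N

      ℓ-step : ∀ {a b} → n' ≤ a → a < b → b ≤ N → ℓ a b ≡ step a
      ℓ-step n'≤a a<b b≤N with m≤n⇒∃[o]m+o≡n a<b
      ... | d , refl = ℓ-descending descending _ d n'≤a b≤N

      homogeneous : ∀ {i j} → i < j → j < suc n' → colour (step (n' + i)) (step (n' + j)) ≡ c
      homogeneous {i} {j} i<j j<n = trans (sym (colour-sorted (step-< (m≤m+n n' i) n'+i<n'+j (n'+i<N j<n))))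
        (subst₂ (λ x y → colour (x ⊔ y) (x ⊓ y) ≡ c)
          (ℓ-step (m≤m+n n' i) n'+i<n'+j (<⇒≤ (n'+i<N j<n)))
          (ℓ-step (m≤m+n n' j) (n'+i<N j<n) ≤-refl)
          (monochromatic n'+i<n'+j (n'+i<N j<n) ≤-refl))
        where
        n'+i<n'+j : n' + i < n' + j
        n'+i<n'+j = +-monoʳ-< n' i<j

    homogeneous-chain : ∀ n' → n' + suc n' ≤ N →
                        Σ (List ℕ) λ ds → Combination K (suc n') ds × Homogeneous colour c ds
    homogeneous-chain n' 2n≤N with Unimodal.unimodal step N steps-distinct no-valley n' (<-≤-trans (m<m+n n' z<s) 2n≤N)
    ... | inj₁ ascending  = ascending-chain n' (≤-trans (m≤n+m (suc n') n') 2n≤N) ascending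
    ... | inj₂ descending = descending-chain n' 2n≤N descending

levelColouring : ∀ {M} → ℕ → (ℕ → ℕ → Fin 2) → TripleColouring M
levelColouring K colour i j k = colour (x ⊔ y) (x ⊓ y)
  where
  x y : ℕ
  x = level K (toℕ i) (toℕ j)
  y = level K (toℕ j) (toℕ k)

module ConvexSubsequence (K N : ℕ) (f : Fin (suc N) → Fin (2 ^ K)) (f-increasing : StrictlyIncreasing f)
  (convex : ConvexPosition (λ a → point K (toℕ (f a)))) where

  -- junk value for t > N
  idx : ℕ → Fin (suc N)
  idx t = t mod suc N

  toℕ-idx : ∀ {t} → t ≤ N → toℕ (idx t) ≡ t
  toℕ-idx t≤N = trans (Fin.toℕ-fromℕ< _) (m<n⇒m%n≡m (s≤s t≤N))

  idx-≢ : ∀ {i j} → i < j → j ≤ N → idx i ≢ idx j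
  idx-≢ i<j j≤N eq =
    <⇒≢ i<j (trans (sym (toℕ-idx (<⇒≤ (<-≤-trans i<j j≤N)))) (trans (cong toℕ eq) (toℕ-idx j≤N)))

  s : ℕ → ℕ
  s t = toℕ (f (idx t))

  idx-< : ∀ {i j} → i < j → j ≤ N → idx i Fin.< idx j
  idx-< i<j j≤N = subst₂ _<_ (sym (toℕ-idx (<⇒≤ (<-≤-trans i<j j≤N)))) (sym (toℕ-idx j≤N)) i<j

  s-increasing : ∀ {i j} → i < j → j ≤ N → s i < s j
  s-increasing {i} {j} i<j j≤N = f-increasing (idx i) (idx j) (idx-< i<j j≤N)

  open LevelSequence K N s s-increasing (λ _ → Fin.toℕ<n _) public

  P : ℕ → Point
  P t = point K (s t)

  private
    k≤N⇒j≤N : ∀ {j k} → j < k → k ≤ N → j ≤ N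
    k≤N⇒j≤N j<k k≤N = <⇒≤ (<-≤-trans j<k k≤N)

  cup : ∀ {i j k} → i < j → j < k → k ≤ N → ℓ i j < ℓ j k → 0ℚ ℚ.< orient (P i) (P j) (P k)
  cup i<j j<k k≤N =
    orient-point-pos K (s-increasing i<j (k≤N⇒j≤N j<k k≤N)) (s-increasing j<k k≤N) (Fin.toℕ<n _)

  cap : ∀ {i j k} → i < j → j < k → k ≤ N → ℓ j k < ℓ i j → orient (P i) (P j) (P k) ℚ.< 0ℚ
  cap i<j j<k k≤N =
    orient-point-neg K (s-increasing i<j (k≤N⇒j≤N j<k k≤N)) (s-increasing j<k k≤N) (Fin.toℕ<n _)

  swapped-cap : ∀ {i j k} → i < j → j < k → k ≤ N → ℓ j k < ℓ i j → 0ℚ ℚ.< orient (P i) (P k) (P j)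
  swapped-cap {i} {j} {k} i<j j<k k≤N lt =
    subst (0ℚ ℚ.<_) (sym (orient-swap (P i) (P j) (P k))) (ℚ.neg-antimono-< (cap i<j j<k k≤N lt))

  module _ (x : ℕ) (x₃≤N : suc (suc (suc x)) ≤ N) (valley₀ : step (suc x) < step x)
           (valley₂ : step (suc x) < step (suc (suc x))) where
    private
      x₁ x₂ x₃ : ℕ
      x₁ = suc x
      x₂ = suc x₁
      x₃ = suc x₂
      x<x₁ : x < x₁
      x<x₁ = n<1+n x
      x₁<x₂ : x₁ < x₂
      x₁<x₂ = n<1+n x₁
      x₂<x₃ : x₂ < x₃
      x₂<x₃ = n<1+n x₂
      x₂≤N : x₂ ≤ N
      x₂≤N = <⇒≤ x₃≤N
      ℓ-x-x₂ : ℓ x x₂ ≡ step x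
      ℓ-x-x₂ = trans (ℓ-join x<x₁ x₁<x₂ x₂≤N) (m≥n⇒m⊔n≡m (<⇒≤ valley₀))
      ℓ-x₁-x₃ : ℓ x₁ x₃ ≡ step x₂
      ℓ-x₁-x₃ = trans (ℓ-join x₁<x₂ x₂<x₃ x₃≤N) (m≤n⇒m⊔n≡n (<⇒≤ valley₂))

    -- P x₁ lies in the triangle P x , P x₂ , P x₃
    rising-valley : step x < step x₂ → ⊥
    rising-valley rise = convex (idx x₁) (inHullExcept-triangle (λ a → point K (toℕ (f a)))
      (≢-sym (idx-≢ x<x₁ (<⇒≤ x₂≤N))) (idx-≢ x₁<x₂ x₂≤N) (idx-≢ (<-trans x₁<x₂ x₂<x₃) x₃≤N)
      (cup (<-trans x<x₁ x₁<x₂) x₂<x₃ x₃≤N (subst (_< step x₂) (sym ℓ-x-x₂) rise))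
      (ℚ.<⇒≤ (cup x₁<x₂ x₂<x₃ x₃≤N valley₂))
      (ℚ.<⇒≤ (cup x<x₁ (<-trans x₁<x₂ x₂<x₃) x₃≤N (subst (step x <_) (sym ℓ-x₁-x₃) rise)))
      (ℚ.<⇒≤ (swapped-cap x<x₁ x₁<x₂ x₂≤N valley₀)))

    -- P x₂ lies in the triangle P x , P x₃ , P x₁
    falling-valley : step x₂ < step x → ⊥
    falling-valley fall = convex (idx x₂) (inHullExcept-triangle (λ a → point K (toℕ (f a)))
      (≢-sym (idx-≢ (<-trans x<x₁ x₁<x₂) x₂≤N)) (idx-≢ x₂<x₃ x₃≤N) (≢-sym (idx-≢ x₁<x₂ x₂≤N))
      (swapped-cap x<x₁ (<-trans x₁<x₂ x₂<x₃) x₃≤N (subst (_< step x) (sym ℓ-x₁-x₃) fall))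
      (ℚ.<⇒≤ (subst (0ℚ ℚ.<_) (sym (orient-rotate (P x₁) (P x₂) (P x₃))) (cup x₁<x₂ x₂<x₃ x₃≤N valley₂)))
      (ℚ.<⇒≤ (swapped-cap x<x₁ x₁<x₂ x₂≤N valley₀))
      (ℚ.<⇒≤ (swapped-cap (<-trans x<x₁ x₁<x₂) x₂<x₃ x₃≤N (subst (step x₂ <_) (sym ℓ-x-x₂) fall))))

    no-valley : ⊥
    no-valley with <-cmp (step x) (step x₂)
    ... | tri< rise _ _ = rising-valley rise
    ... | tri> _ _ fall = falling-valley fall
    ... | tri≈ _ eq _   = proj₁ (ℓ-ultrametric x<x₁ (<-trans x₁<x₂ x₂<x₃) x₃≤N) (trans eq (sym ℓ-x₁-x₃))

  homogeneous-subset : ∀ colour c → Monochromatic (levelColouring K colour) f c → ∀ n' → n' + suc n' ≤ N →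
                       Σ (List ℕ) λ ds → Combination K (suc n') ds × Homogeneous colour c ds
  homogeneous-subset colour c mono = homogeneous-chain colour c monochromatic no-valley
    where
    monochromatic : ∀ {i j k} → i < j → j < k → k ≤ N → colour (ℓ i j ⊔ ℓ j k) (ℓ i j ⊓ ℓ j k) ≡ c
    monochromatic {i} {j} {k} i<j j<k k≤N =
      mono (idx i) (idx j) (idx k) (idx-< i<j (<⇒≤ (<-≤-trans j<k k≤N))) (idx-< j<k k≤N)

lemma3 : Σ ℕ λ n₀ → (n : ℕ) → n ≥ n₀ →
    Σ (Fin (2 ^ (2 ^ (n / 2))) → Point) λ V →
    Injective _≡_ _≡_ V × GeneralPosition V ×
    Σ (TripleColouring (2 ^ (2 ^ (n / 2)))) λ χ →
    (f : Fin (2 * n) → Fin (2 ^ (2 ^ (n / 2)))) → StrictlyIncreasing f →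
    ConvexPosition (λ a → V (f a)) → (c : Fin 2) → Monochromatic χ f c → ⊥
lemma3 .proj₁ = 4
lemma3 .proj₂ (suc n') 4≤n =
  V , V-injective , points-generalPosition K , levelColouring K colour , no-monochromatic
  where
  n h K : ℕ
  n = suc n'
  h = n / 2
  K = 2 ^ h
  V : Fin (2 ^ K) → Point
  V i = point K (toℕ i)
  V-injective : Injective _≡_ _≡_ V
  V-injective eq = Fin.toℕ-injective (toℚ-injective (cong proj₁ eq))
  ramsey : Σ (ℕ → ℕ → Fin 2) λ colour → ∀ c ds → Combination K n ds → ¬ Homogeneous colour c ds
  ramsey = ramsey-lower-bound h n (subst (_≤ n) (*-comm h 2) (m/n*n≤m n 2)) 4≤n
  colour : ℕ → ℕ → Fin 2
  colour = proj₁ ramsey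
  no-monochromatic : (f : Fin (2 * n) → Fin (2 ^ K)) → StrictlyIncreasing f →
    ConvexPosition (λ a → V (f a)) → (c : Fin 2) → Monochromatic (levelColouring K colour) f c → ⊥
  -- the module is instantiated at N = n' + suc (n' + 0), since 2 * n reduces to suc N
  no-monochromatic f f-increasing convex c mono =
    let ds , ds-combination , ds-homogeneous =
          ConvexSubsequence.homogeneous-subset K _ f f-increasing convex colour c mono n'
            (≤-reflexive (cong (λ m → n' + suc m) (sym (+-identityʳ n'))))
    in proj₂ ramsey c ds ds-combination ds-homogeneous
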